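{- Let $n\geq 4$ be an integer and let $M$ be a perfect matching of the folded hypercube $FQ_n$. Then $FQ_n-M$ (obtained from $FQ_n$ by deleting the edges of $M$) is isomorphic to the hypercube $Q_n$ if and only if $M=E_c$ or $M=E^i$ for some $i\in\{1,2,\dots,n\}$.
   Context: The $n$-dimensional hypercube $Q_n$ has vertex set $\{0,1\}^n$ (binary strings $x_1x_2\cdots x_n$), two vertices being adjacent iff they differ in exactly one position. The $n$-dimensional folded hypercube $FQ_n$ is obtained from $Q_n$ by adding the $2^{n-1}$ complementary edges joining each $x_1x_2\cdots x_n$ to $\overline{x}_1\overline{x}_2\cdots\overline{x}_n$, where $\overline{x}_i=1-x_i$. $E_c$ denotes the set of all complementary edges of $FQ_n$, and for $1\le i\le n$, $E^i$ denotes the set of $i$-dimensional edges of $Q_n$, i.e. edges $uv$ of $Q_n$ such that $u$ and $v$ differ only in the $i$-th position. A perfect matching of a graph $G$ is a set of pairwise vertex-disjoint edges covering every vertex. -}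

module Defs where

open import Data.Nat using (ℕ)
open import Data.Bool using (Bool; not)
open import Data.Fin using (Fin)
open import Data.Vec using (Vec; map; _[_]%=_)
open import Data.Product using (Σ; ∃; _×_)
open import Data.Sum using (_⊎_)
open import Relation.Binary.PropositionalEquality using (_≡_; _≢_)
open import Relation.Nullary using (¬_)
open import Function.Bundles using (_⤖_; _⇔_; Bijection)

Vtx : ℕ → Set
Vtx n = Vec Bool n

flip : ∀ {n} → Fin n → Vtx n → Vtx n
flip i u = u [ i ]%= not

compl : ∀ {n} → Vtx n → Vtx n
compl u = map not u

DimEdge : ∀ {n} → Fin n → Vtx n → Vtx n → Set
DimEdge i u v = v ≡ flip i u

QAdj : ∀ {n} → Vtx n → Vtx n → Set
QAdj {n} u v = ∃ λ (i : Fin n) → DimEdge i u v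

CompEdge : ∀ {n} → Vtx n → Vtx n → Set
CompEdge u v = v ≡ compl u

FQAdj : ∀ {n} → Vtx n → Vtx n → Set
FQAdj u v = QAdj u v ⊎ CompEdge u v

-- A perfect matching of FQ_n, given by its partner map: every vertex u is
-- covered by exactly one edge {u, partner u} of M; the edge lies in FQ_n.
record PerfectMatching (n : ℕ) : Set where
  field
    partner     : Vtx n → Vtx n
    involutive  : ∀ u → partner (partner u) ≡ u
    edge        : ∀ u → FQAdj u (partner u)

open PerfectMatching public

InM : ∀ {n} → PerfectMatching n → Vtx n → Vtx n → Set
InM M u v = v ≡ partner M u

FQminusAdj : ∀ {n} → PerfectMatching n → Vtx n → Vtx n → Set
FQminusAdj M u v = FQAdj u v × ¬ InM M u v

Isomorphic : ∀ {n} → (Vtx n → Vtx n → Set) → (Vtx n → Vtx n → Set) → Set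
Isomorphic {n} A B =
  Σ (Vtx n ⤖ Vtx n) λ f →
    ∀ u v → A u v ⇔ B (Bijection.to f u) (Bijection.to f v)

IsEc : ∀ {n} → PerfectMatching n → Set
IsEc M = ∀ u v → InM M u v ⇔ CompEdge u v

IsEi : ∀ {n} → Fin n → PerfectMatching n → Set
IsEi i M = ∀ u v → InM M u v ⇔ DimEdge i u v

-- The edges of FQₙ at a vertex v are v–g v for the n+1 moves g: flipping one coordinate, or
-- complementing. A perfect matching M assigns to each vertex u the move of its matched edge, its
-- direction. In Qₙ any two edges at a vertex lie on a 4-cycle, so the same holds in FQₙ − M when
-- it is isomorphic to Qₙ; and for n ≥ 4 the only 4-cycle of FQₙ through v–bv and v–cv is the
-- commuting square v, bv, cbv, cv. So if b is not the direction at v, the direction at u = bv is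
-- that of v: otherwise, with c the direction at u, the 4-cycle through the edges v–u and v–cv of
-- FQₙ − M would contain the matched edge u–cu. The direction is thus invariant under every flip
-- and, Qₙ being connected, constant: M = E_c or M = E^i. Conversely FQₙ − E_c is Qₙ, and the
-- involution x ↦ x for xᵢ = 0, x ↦ complement of (flip i x) for xᵢ = 1 exchanges complementation
-- and the i-flip and commutes with the other flips, so it maps FQₙ − E^i onto Qₙ.
module Submission where

open import Defs
open import Data.Bool using (Bool; true; false; not; _xor_; if_then_else_)
open import Data.Bool.Properties using (xor-assoc; xor-comm; xor-same; xor-identityʳ)
open import Data.Fin using (Fin; zero; suc; _≟_)
open import Data.Fin.Properties using (¬∀⟶∃¬; any?; injective⇒≤)
open import Data.Nat using (ℕ; zero; suc; _<_; _≥_; s≤s; z≤n)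
open import Data.Nat.Properties using (<⇒≱; <-trans)
open import Data.Product using (∃; _×_; _,_; proj₁; proj₂; curry; map₂)
open import Data.Sum using (_⊎_; inj₁; inj₂)
open import Data.Vec using (Vec; []; _∷_; lookup; replicate)
open import Data.Vec.Properties using (lookup-map; lookup∘updateAt; lookup∘updateAt′)
open import Data.Vec.Relation.Binary.Pointwise.Extensional using (ext; Pointwise-≡⇒≡)
open import Function using (_∘_; id)
open import Function.Bundles using (_⇔_; Bijection; mk⇔; mk↔ₛ′)
open Function.Bundles.Equivalence using (to; from)
open import Function.Properties.Inverse using (↔⇒⤖)
open import Relation.Binary.PropositionalEquality
open import Relation.Nullary using (¬_; Dec; yes; no; does; contradiction)
open import Relation.Nullary.Decidable using (dec-true; dec-false; map′)

private
  variable
    n : ℕ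

fresh : ∀ {m} (ps : Vec (Fin n) m) → m < n → ∃ λ k → ∀ i → lookup ps i ≢ k
fresh {n} {m} ps m<n =
  map₂ curry (¬∀⟶∃¬ n _ (λ k → any? λ i → lookup ps i ≟ k) ps-not-onto)
  where
  ps-not-onto : ¬ (∀ k → ∃ λ i → lookup ps i ≡ k)
  ps-not-onto onto = <⇒≱ m<n (injective⇒≤ {f = proj₁ ∘ onto} λ {k} {l} e →
    trans (sym (proj₂ (onto k))) (trans (cong (lookup ps) e) (proj₂ (onto l))))

xor-cancelʳ : ∀ z {x y} → x xor z ≡ y xor z → x ≡ y
xor-cancelʳ z {x} {y} eq = trans (sym (xor-z-z x)) (trans (cong (_xor z) eq) (xor-z-z y))
  where
  xor-z-z : ∀ x → (x xor z) xor z ≡ x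
  xor-z-z x = trans (xor-assoc x z z) (trans (cong (x xor_) (xor-same z)) (xor-identityʳ x))

data Move (n : ℕ) : Set where
  dim  : Fin n → Move n
  comp : Move n

dim-injective : ∀ {i j : Fin n} → dim i ≡ dim j → i ≡ j
dim-injective refl = refl

_≟ₘ_ : (g h : Move n) → Dec (g ≡ h)
dim i ≟ₘ dim j = map′ (cong dim) dim-injective (i ≟ j)
dim _ ≟ₘ comp  = no λ ()
comp  ≟ₘ dim _ = no λ ()
comp  ≟ₘ comp  = yes refl

move : Move n → Vtx n → Vtx n
move (dim i) = flip i
move comp    = compl

moved : Move n → Fin n → Bool
moved (dim i) k = does (i ≟ k)
moved comp    k = true

moved-self : (i : Fin n) → moved (dim i) i ≡ true
moved-self i = dec-true (i ≟ i) refl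

moved-other : {i k : Fin n} → i ≢ k → moved (dim i) k ≡ false
moved-other {i = i} {k} = dec-false (i ≟ k)

lookup-move : ∀ g (v : Vtx n) k → lookup (move g v) k ≡ moved g k xor lookup v k
lookup-move (dim i) v k with i ≟ k
... | yes refl = lookup∘updateAt i v
... | no  i≢k  = lookup∘updateAt′ k i (i≢k ∘ sym) v
lookup-move comp v k = lookup-map k not v

lookup-move² : ∀ g h (v : Vtx n) k →
  lookup (move g (move h v)) k ≡ (moved g k xor moved h k) xor lookup v k
lookup-move² g h v k = begin
  lookup (move g (move h v)) k              ≡⟨ lookup-move g (move h v) k ⟩
  moved g k xor lookup (move h v) k         ≡⟨ cong (moved g k xor_) (lookup-move h v k) ⟩
  moved g k xor (moved h k xor lookup v k)  ≡⟨ xor-assoc (moved g k) (moved h k) (lookup v k) ⟨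
  (moved g k xor moved h k) xor lookup v k  ∎
  where open ≡-Reasoning

move-involutive : ∀ g (v : Vtx n) → move g (move g v) ≡ v
move-involutive g v = Pointwise-≡⇒≡ (ext λ k →
  trans (lookup-move² g g v k) (cong (_xor lookup v k) (xor-same (moved g k))))

move-comm : ∀ g h (v : Vtx n) → move g (move h v) ≡ move h (move g v)
move-comm g h v = Pointwise-≡⇒≡ (ext λ k → begin
  lookup (move g (move h v)) k              ≡⟨ lookup-move² g h v k ⟩
  (moved g k xor moved h k) xor lookup v k  ≡⟨ cong (_xor lookup v k) (xor-comm (moved g k) (moved h k)) ⟩
  (moved h k xor moved g k) xor lookup v k  ≡⟨ lookup-move² h g v k ⟨
  lookup (move h (move g v)) k              ∎)
  where open ≡-Reasoning

move≡⇒moved≡ : ∀ g h {v : Vtx n} → move g v ≡ move h v → ∀ k → moved g k ≡ moved h k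
move≡⇒moved≡ g h {v} eq k = xor-cancelʳ (lookup v k)
  (trans (sym (lookup-move g v k)) (trans (cong (λ w → lookup w k) eq) (lookup-move h v k)))

moved-square : ∀ d b e c {v : Vtx n} → move d (move b v) ≡ move e (move c v) →
  ∀ k {x y z w} → moved d k ≡ x → moved b k ≡ y → moved e k ≡ z → moved c k ≡ w →
  x xor y ≡ z xor w
moved-square d b e c {v} eq k refl refl refl refl = xor-cancelʳ (lookup v k)
  (trans (sym (lookup-move² d b v k)) (trans (cong (λ w → lookup w k) eq) (lookup-move² e c v k)))

module _ (1<n : 1 < n) where

  move-injective : ∀ {g h} {v : Vtx n} → move g v ≡ move h v → g ≡ h
  move-injective {g = dim i} {dim j} eq with j ≟ i
  ... | yes j≡i = cong dim (sym j≡i)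
  ... | no  j≢i = contradiction
    (trans (sym (moved-self i)) (trans (move≡⇒moved≡ (dim i) (dim j) eq i) (moved-other j≢i))) λ ()
  move-injective {g = dim i} {comp} eq with k , i≢k ← fresh (i ∷ []) 1<n =
    contradiction (trans (sym (moved-other (i≢k zero))) (move≡⇒moved≡ (dim i) comp eq k)) λ ()
  move-injective {g = comp} {dim j} eq with k , j≢k ← fresh (j ∷ []) 1<n =
    contradiction (trans (move≡⇒moved≡ comp (dim j) eq k) (moved-other (j≢k zero))) λ ()
  move-injective {g = comp} {comp} eq = refl

adj⇒move : {u v : Vtx n} → FQAdj u v → ∃ λ g → v ≡ move g u
adj⇒move (inj₁ (i , v≡iu)) = dim i , v≡iu
adj⇒move (inj₂ v≡cu)       = comp , v≡cu

move-adj : ∀ g (u : Vtx n) → FQAdj u (move g u)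
move-adj (dim i) u = inj₁ (i , refl)
move-adj comp    u = inj₂ refl

module _ (3<n : 3 < n) where

  private
    avoid : (i j l : Fin n) →
      ∃ λ k → moved (dim i) k ≡ false × moved (dim j) k ≡ false × moved (dim l) k ≡ false
    avoid i j l with k , ∉ ← fresh (i ∷ j ∷ l ∷ []) 3<n =
      k , moved-other (∉ zero) , moved-other (∉ (suc zero)) , moved-other (∉ (suc (suc zero)))

  -- n ≥ 4 is needed here: in FQ₃ complementing equals flipping all three coordinates.
  commuting-square-unique : ∀ {d b e c} {v : Vtx n} →
    move d (move b v) ≡ move e (move c v) → b ≢ c → d ≢ b → d ≡ c
  commuting-square-unique {b = comp} {c = comp} _ b≢c _ = contradiction refl b≢c
  commuting-square-unique {d = comp} {comp} _ _ d≢b = contradiction refl d≢b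
  commuting-square-unique {d = dim i} {comp} {comp} {dim j} sq _ _ with j ≟ i
  ... | yes j≡i = cong dim (sym j≡i)
  ... | no  j≢i = contradiction
    (moved-square (dim i) comp comp (dim j) sq i (moved-self i) refl refl (moved-other j≢i)) λ ()
  commuting-square-unique {d = dim i} {comp} {dim l} {dim j} sq _ _
    with k , i₀ , l₀ , j₀ ← avoid i l j =
    contradiction (moved-square (dim i) comp (dim l) (dim j) sq k i₀ refl l₀ j₀) λ ()
  commuting-square-unique {d = comp} {dim j} {c = comp} _ _ _ = refl
  commuting-square-unique {d = dim i} {dim j} {comp} {comp} sq _ d≢b = contradiction
    (moved-square (dim i) (dim j) comp comp sq j (moved-other (d≢b ∘ cong dim)) (moved-self j) refl refl)
    λ ()
  commuting-square-unique {d = dim i} {dim j} {dim l} {comp} sq _ _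
    with k , i₀ , j₀ , l₀ ← avoid i j l =
    contradiction (moved-square (dim i) (dim j) (dim l) comp sq k i₀ j₀ l₀ refl) λ ()
  commuting-square-unique {d = comp} {dim j} {comp} {dim l} sq b≢c _ = contradiction
    (moved-square comp (dim j) comp (dim l) sq j refl (moved-self j) refl (moved-other (b≢c ∘ cong dim ∘ sym)))
    λ ()
  commuting-square-unique {d = comp} {dim j} {dim m} {dim l} sq _ _
    with k , j₀ , l₀ , m₀ ← avoid j l m =
    contradiction (moved-square comp (dim j) (dim m) (dim l) sq k refl j₀ m₀ l₀) λ ()
  commuting-square-unique {d = dim i} {dim j} {comp} {dim l} sq _ _
    with k , i₀ , j₀ , l₀ ← avoid i j l =
    contradiction (moved-square (dim i) (dim j) comp (dim l) sq k i₀ j₀ refl l₀) λ ()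
  commuting-square-unique {d = dim i} {dim j} {dim m} {dim l} sq b≢c d≢b with l ≟ i | m ≟ i
  ... | yes l≡i | _        = cong dim (sym l≡i)
  ... | no  l≢i | yes refl = contradiction
    (moved-square (dim i) (dim j) (dim i) (dim l) sq j
       (moved-other (d≢b ∘ cong dim)) (moved-self j) (moved-other (d≢b ∘ cong dim))
       (moved-other (b≢c ∘ cong dim ∘ sym)))
    λ ()
  ... | no  l≢i | no  m≢i  = contradiction
    (moved-square (dim i) (dim j) (dim m) (dim l) sq i
       (moved-self i) (moved-other (d≢b ∘ cong dim ∘ sym)) (moved-other m≢i) (moved-other l≢i))
    λ ()

  FQ-square-closes : ∀ {b c} {v x : Vtx n} → b ≢ c →
    FQAdj (move b v) x → FQAdj (move c v) x → x ≢ v → x ≡ move c (move b v)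
  FQ-square-closes {b = b} {c} {v} {x} b≢c bv~x cv~x x≢v
    with d , x≡dbv ← adj⇒move bv~x | e , x≡ecv ← adj⇒move cv~x =
    trans x≡dbv (cong (λ g → move g (move b v)) d≡c)
    where
    d≡c : d ≡ c
    d≡c = commuting-square-unique {d} {b} {e} {c} (trans (sym x≡dbv) x≡ecv) b≢c
      λ { refl → x≢v (trans x≡dbv (move-involutive b v)) }

HasSquares : (Vtx n → Vtx n → Set) → Set
HasSquares {n} A =
  ∀ {v u w : Vtx n} → A v u → A v w → u ≢ w → ∃ λ x → A u x × A w x × x ≢ v

Q-hasSquares : HasSquares (QAdj {n})
Q-hasSquares {v = v} (i , refl) (j , refl) iv≢jv =
  flip j (flip i v) , (j , refl) , (i , move-comm (dim j) (dim i) v) ,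
  λ jiv≡v → iv≢jv (trans (sym (move-involutive (dim j) (flip i v))) (cong (flip j) jiv≡v))

hasSquares-transport : {A B : Vtx n → Vtx n → Set} →
  Isomorphic A B → HasSquares B → HasSquares A
hasSquares-transport {A = A} {B} (f , A⇔B) squares {v} {u} {w} v~u v~w u≢w
  with y , Fu~y , Fw~y , y≢Fv ←
         squares (to (A⇔B v u) v~u) (to (A⇔B v w) v~w) (u≢w ∘ Bijection.injective f)
  with x , Fx≡y ← Bijection.strictlySurjective f y =
  x , from (A⇔B u x) (subst (B (F u)) (sym Fx≡y) Fu~y) ,
      from (A⇔B w x) (subst (B (F w)) (sym Fx≡y) Fw~y) ,
      λ x≡v → y≢Fv (trans (sym Fx≡y) (cong F x≡v))
  where
  F = Bijection.to f

flip-induction : (P : Vtx n → Set) →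
  P (replicate n false) → (∀ i v → P v → P (flip i v)) → ∀ v → P v
flip-induction {zero}  P p₀ step []      = p₀
flip-induction {suc n} P p₀ step (x ∷ v) =
  extend x (flip-induction (P ∘ (false ∷_)) p₀ (λ i w → step (suc i) (false ∷ w)) v)
  where
  extend : ∀ x → P (false ∷ v) → P (x ∷ v)
  extend false p = p
  extend true  p = step zero (false ∷ v) p

direction : PerfectMatching n → Vtx n → Move n
direction M u = proj₁ (adj⇒move (edge M u))

partner≡move-direction : (M : PerfectMatching n) → ∀ u → partner M u ≡ move (direction M u) u
partner≡move-direction M u = proj₂ (adj⇒move (edge M u))

module _ (1<n : 1 < n) (M : PerfectMatching n) where

  direction-unique : ∀ {g u} → move g u ≡ partner M u → g ≡ direction M u
  direction-unique {u = u} gu≡Mu =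
    move-injective 1<n (trans gu≡Mu (partner≡move-direction M u))

  direction-partner : ∀ u → direction M (partner M u) ≡ direction M u
  direction-partner u = sym (direction-unique (begin
    move a (partner M u)     ≡⟨ cong (move a) (partner≡move-direction M u) ⟩
    move a (move a u)        ≡⟨ move-involutive a u ⟩
    u                        ≡⟨ involutive M u ⟨
    partner M (partner M u)  ∎))
    where
    open ≡-Reasoning
    a = direction M u

  unmatched-move : ∀ {g v} → g ≢ direction M v → FQminusAdj M v (move g v)
  unmatched-move {g} {v} g≢a = move-adj g v , g≢a ∘ direction-unique

  direction-not-back : ∀ {b v} → b ≢ direction M v → direction M (move b v) ≢ b
  direction-not-back {b} {v} b≢a c≡b = b≢a (direction-unique (sym (begin
    partner M v                       ≡⟨ cong (partner M) Mu≡v ⟨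
    partner M (partner M (move b v))  ≡⟨ involutive M (move b v) ⟩
    move b v                          ∎)))
    where
    open ≡-Reasoning
    Mu≡v : partner M (move b v) ≡ v
    Mu≡v = trans (partner≡move-direction M (move b v))
                 (trans (cong (λ g → move g (move b v)) c≡b) (move-involutive b v))

module _ (3<n : 3 < n) (M : PerfectMatching n) (squares : HasSquares (FQminusAdj M)) where

  private
    1<n : 1 < n
    1<n = <-trans (s≤s (s≤s z≤n)) 3<n

  direction-move : ∀ {b v} → b ≢ direction M v → direction M (move b v) ≡ direction M v
  direction-move {b} {v} b≢a with direction M (move b v) ≟ₘ direction M v
  ... | yes c≡a = c≡a
  ... | no  c≢a
    with x , u~x , w~x , x≢v ← squares (unmatched-move 1<n M b≢a) (unmatched-move 1<n M c≢a)
                                        (direction-not-back 1<n M b≢a ∘ sym ∘ move-injective 1<n) =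
    contradiction
      (trans (FQ-square-closes 3<n (direction-not-back 1<n M b≢a ∘ sym) (proj₁ u~x) (proj₁ w~x) x≢v)
             (sym (partner≡move-direction M (move b v))))
      (proj₂ u~x)

  direction-flip : ∀ i v → direction M (flip i v) ≡ direction M v
  direction-flip i v with dim i ≟ₘ direction M v
  ... | no  i≢a = direction-move i≢a
  ... | yes i≡a = trans (cong (direction M) iv≡Mv) (direction-partner 1<n M v)
    where
    iv≡Mv : flip i v ≡ partner M v
    iv≡Mv = trans (cong (λ g → move g v) i≡a) (sym (partner≡move-direction M v))

  uniform-matching : ∃ λ t → ∀ u → partner M u ≡ move t u
  uniform-matching =
    direction M 0v , λ u → trans (partner≡move-direction M u) (cong (λ g → move g u) (constant u))
    where
    0v = replicate n false
    constant : ∀ u → direction M u ≡ direction M 0v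
    constant = flip-induction (λ u → direction M u ≡ direction M 0v) refl
                              (λ i v eq → trans (direction-flip i v) eq)

swap : Fin n → Move n → Move n
swap i (dim j) = if does (j ≟ i) then comp else dim j
swap i comp    = dim i

swap-self : (i : Fin n) → swap i (dim i) ≡ comp
swap-self i = cong (if_then comp else dim i) (moved-self i)

swap-fixing : ∀ i g → moved g i ≡ false → swap {n} i g ≡ g
swap-fixing i (dim j) gᵢ = cong (if_then comp else dim j) gᵢ
swap-fixing i comp    ()

compl-flip-involutive : ∀ (i : Fin n) x → compl (flip i (compl (flip i x))) ≡ x
compl-flip-involutive i x = begin
  compl (flip i (compl (flip i x)))  ≡⟨ cong compl (move-comm (dim i) comp (flip i x)) ⟩
  compl (compl (flip i (flip i x)))  ≡⟨ move-involutive comp (flip i (flip i x)) ⟩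
  flip i (flip i x)                  ≡⟨ move-involutive (dim i) x ⟩
  x                                  ∎
  where open ≡-Reasoning

compl-flip-move : ∀ (i : Fin n) g x → compl (flip i (move g x)) ≡ move g (compl (flip i x))
compl-flip-move i g x = trans (cong compl (move-comm (dim i) g x)) (move-comm comp g (flip i x))

swap-flipping : ∀ i g (x : Vtx n) → moved g i ≡ true →
  move (swap i g) x ≡ compl (flip i (move g x))
swap-flipping i comp x _ =
  sym (trans (cong compl (move-comm (dim i) comp x)) (move-involutive comp (flip i x)))
swap-flipping i (dim j) x gᵢ with j ≟ i
... | yes refl = cong compl (sym (move-involutive (dim i) x))
... | no  _    = contradiction gᵢ λ ()

twist : Fin n → Vtx n → Vtx n
twist i x = if lookup x i then compl (flip i x) else x

module _ (i : Fin n) where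

  twist-off : ∀ x → lookup x i ≡ false → twist i x ≡ x
  twist-off x xᵢ = cong (if_then compl (flip i x) else x) xᵢ

  twist-on : ∀ x → lookup x i ≡ true → twist i x ≡ compl (flip i x)
  twist-on x xᵢ = cong (if_then compl (flip i x) else x) xᵢ

  -- The case splits below are on a fresh Bool: 'with lookup x i' would also rewrite the
  -- occurrences of 'lookup x i' inside the unfolded 'twist i x' in the goal.
  twist-involutive : ∀ x → twist i (twist i x) ≡ x
  twist-involutive x = cases (lookup x i) refl
    where
    open ≡-Reasoning
    lookup-compl-flip : lookup (compl (flip i x)) i ≡ lookup x i
    lookup-compl-flip =
      trans (lookup-move² comp (dim i) x i) (cong (λ b → not b xor lookup x i) (moved-self i))
    cases : ∀ γ → lookup x i ≡ γ → twist i (twist i x) ≡ x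
    cases false xᵢ = trans (cong (twist i) (twist-off x xᵢ)) (twist-off x xᵢ)
    cases true  xᵢ = begin
      twist i (twist i x)                ≡⟨ cong (twist i) (twist-on x xᵢ) ⟩
      twist i (compl (flip i x))         ≡⟨ twist-on (compl (flip i x)) (trans lookup-compl-flip xᵢ) ⟩
      compl (flip i (compl (flip i x)))  ≡⟨ compl-flip-involutive i x ⟩
      x                                  ∎

  twist-move : ∀ g x → twist i (move g x) ≡ move (swap i g) (twist i x)
  twist-move g x = cases (moved g i) (lookup x i) refl refl
    where
    open ≡-Reasoning
    gx-bit : ∀ {β γ} → moved g i ≡ β → lookup x i ≡ γ → lookup (move g x) i ≡ β xor γ
    gx-bit gᵢ xᵢ = trans (lookup-move g x i) (cong₂ _xor_ gᵢ xᵢ)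
    cases : ∀ β γ → moved g i ≡ β → lookup x i ≡ γ →
      twist i (move g x) ≡ move (swap i g) (twist i x)
    cases true true gᵢ xᵢ = begin
      twist i (move g x)                          ≡⟨ twist-off (move g x) (gx-bit gᵢ xᵢ) ⟩
      move g x                                    ≡⟨ cong (move g) (compl-flip-involutive i x) ⟨
      move g (compl (flip i (compl (flip i x))))  ≡⟨ compl-flip-move i g _ ⟨
      compl (flip i (move g (compl (flip i x))))  ≡⟨ swap-flipping i g _ gᵢ ⟨
      move (swap i g) (compl (flip i x))          ≡⟨ cong (move (swap i g)) (twist-on x xᵢ) ⟨
      move (swap i g) (twist i x)                 ∎
    cases true false gᵢ xᵢ = begin
      twist i (move g x)                          ≡⟨ twist-on (move g x) (gx-bit gᵢ xᵢ) ⟩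
      compl (flip i (move g x))                   ≡⟨ swap-flipping i g x gᵢ ⟨
      move (swap i g) x                           ≡⟨ cong (move (swap i g)) (twist-off x xᵢ) ⟨
      move (swap i g) (twist i x)                 ∎
    cases false true gᵢ xᵢ = begin
      twist i (move g x)                          ≡⟨ twist-on (move g x) (gx-bit gᵢ xᵢ) ⟩
      compl (flip i (move g x))                   ≡⟨ compl-flip-move i g x ⟩
      move g (compl (flip i x))                   ≡⟨ cong₂ move (swap-fixing i g gᵢ) (twist-on x xᵢ) ⟨
      move (swap i g) (twist i x)                 ∎
    cases false false gᵢ xᵢ = begin
      twist i (move g x)                          ≡⟨ twist-off (move g x) (gx-bit gᵢ xᵢ) ⟩
      move g x                                    ≡⟨ cong₂ move (swap-fixing i g gᵢ) (twist-off x xᵢ) ⟨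
      move (swap i g) (twist i x)                 ∎

-- IsE comp M and IsE (dim i) M are, definitionally, IsEc M and IsEi i M.
IsE : Move n → PerfectMatching n → Set
IsE t M = ∀ u v → InM M u v ⇔ (v ≡ move t u)

IsE⇒partner : ∀ t (M : PerfectMatching n) → IsE t M → ∀ u → partner M u ≡ move t u
IsE⇒partner t M E u = to (E u (partner M u)) refl

partner⇒IsE : ∀ t (M : PerfectMatching n) → (∀ u → partner M u ≡ move t u) → IsE t M
partner⇒IsE t M M≡t u v = mk⇔ (λ v≡Mu → trans v≡Mu (M≡t u)) (λ v≡tu → trans v≡tu (sym (M≡t u)))

module _ (1<n : 1 < n) (M : PerfectMatching n) {t} (M≡t : ∀ u → partner M u ≡ move t u)
         (φ : Vtx n → Vtx n) (φ-involutive : ∀ x → φ (φ x) ≡ x)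
         (σ : Move n → Move n) (σt≡comp : σ t ≡ comp)
         (φ-move : ∀ g x → φ (move g x) ≡ move (σ g) (φ x)) where

  private
    φ-injective : ∀ {x y} → φ x ≡ φ y → x ≡ y
    φ-injective {x} {y} φx≡φy =
      trans (sym (φ-involutive x)) (trans (cong φ φx≡φy) (φ-involutive y))

    φ-matched : ∀ u → φ (partner M u) ≡ compl (φ u)
    φ-matched u =
      trans (cong φ (M≡t u)) (trans (φ-move t u) (cong (λ g → move g (φ u)) σt≡comp))

    adj-image : ∀ {u v} → FQminusAdj M u v → QAdj (φ u) (φ v)
    adj-image {u} {v} (u~v , v≢Mu) with g , v≡gu ← adj⇒move u~v =
      dim-image (σ g) (trans (cong φ v≡gu) (φ-move g u))
      where
      dim-image : ∀ h → φ v ≡ move h (φ u) → QAdj (φ u) (φ v)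
      dim-image (dim j) φv≡jφu = j , φv≡jφu
      dim-image comp    φv≡cφu = contradiction (φ-injective (trans φv≡cφu (sym (φ-matched u)))) v≢Mu

    adj-preimage : ∀ {u v} → QAdj (φ u) (φ v) → FQminusAdj M u v
    adj-preimage {u} {v} (j , φv≡jφu) =
      subst (FQAdj u) (sym v≡σju) (move-adj (σ (dim j)) u) ,
      λ v≡Mu → contradiction
        (move-injective 1<n {dim j} {comp} (trans (sym φv≡jφu) (trans (cong φ v≡Mu) (φ-matched u))))
        λ ()
      where
      v≡σju : v ≡ move (σ (dim j)) u
      v≡σju = trans (sym (φ-involutive v)) (trans (cong φ φv≡jφu)
                (trans (φ-move (dim j) (φ u)) (cong (move (σ (dim j))) (φ-involutive u))))

  conjugation-iso : Isomorphic (FQminusAdj M) QAdj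
  conjugation-iso =
    ↔⇒⤖ (mk↔ₛ′ φ φ φ-involutive φ-involutive) , λ u v → mk⇔ adj-image adj-preimage

IsE⇒iso : 1 < n → ∀ t (M : PerfectMatching n) → IsE t M → Isomorphic (FQminusAdj M) QAdj
IsE⇒iso 1<n comp M E =
  conjugation-iso 1<n M (IsE⇒partner comp M E) id (λ _ → refl) id refl (λ _ _ → refl)
IsE⇒iso 1<n (dim i) M E =
  conjugation-iso 1<n M (IsE⇒partner (dim i) M E)
    (twist i) (twist-involutive i) (swap i) (swap-self i) (twist-move i)

theorem2p3 : (n : ℕ) → n ≥ 4 → (M : PerfectMatching n) →
    Isomorphic (FQminusAdj M) (QAdj {n}) ⇔ (IsEc M ⊎ ∃ λ (i : Fin n) → IsEi i M)
theorem2p3 n n≥4 M = mk⇔ forward backward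
  where
  1<n : 1 < n
  1<n = <-trans (s≤s (s≤s z≤n)) n≥4

  classify : ∀ t → IsE t M → IsEc M ⊎ ∃ λ i → IsEi i M
  classify comp    E = inj₁ E
  classify (dim i) E = inj₂ (i , E)

  forward : Isomorphic (FQminusAdj M) QAdj → IsEc M ⊎ ∃ λ i → IsEi i M
  forward iso with t , M≡t ← uniform-matching n≥4 M (hasSquares-transport iso Q-hasSquares) =
    classify t (partner⇒IsE t M M≡t)

  backward : IsEc M ⊎ ∃ (λ i → IsEi i M) → Isomorphic (FQminusAdj M) QAdj
  backward (inj₁ E)       = IsE⇒iso 1<n comp M E
  backward (inj₂ (i , E)) = IsE⇒iso 1<n (dim i) M E
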